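{- For $e\in\{1,2,3,4\}$ and for any $e$-power factoradic fixed point $p$ of $S_{e,!}$, there exist arbitrarily long sequences of consecutive $e$-power factoradic $p$-happy numbers.
   Context: Every positive integer $n$ has a unique factoradic (factorial base) representation $n=\sum_{i=1}^k a_i\cdot i!$ with $a_k\neq 0$ and $0\leq a_i\leq i$ for $1\leq i\leq k$. For an integer $e\geq 1$, the $e$-power factoradic happy function $S_{e,!}:\mathbb{Z}_{\geq 0}\to\mathbb{Z}_{\geq 0}$ is defined by $S_{e,!}(0)=0$ and $S_{e,!}(n)=\sum_{i=1}^k a_i^e$ for $n\geq 1$; $S_{e,!}^\ell$ denotes the $\ell$-th iterate, with $S_{e,!}^0(n)=n$. A positive integer $p$ with $S_{e,!}(p)=p$ is an $e$-power factoradic fixed point. Given such a $p$, a positive integer $x$ is an $e$-power factoradic $p$-happy number if $S_{e,!}^\ell(x)=p$ for some $\ell\in\mathbb{Z}_{\geq 0}$. -}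

module Defs where

open import Data.Nat using (ℕ; zero; suc; _+_; _^_; _<_; _≤_)
open import Data.Nat.DivMod using (_/_; _%_)
open import Data.List using (List; []; _∷_; map)
open import Data.Nat.ListAction using (sum)
open import Data.Product using (_×_; ∃-syntax)
open import Relation.Binary.PropositionalEquality using (_≡_)

-- Factoradic digits [a₁, a₂, …, a_k] of n (a_i is the coefficient of i!),
-- computed by the standard algorithm: a_i = m mod (i+1), then m := m / (i+1),
-- starting from m = n, i = 1, until m = 0.  The fuel argument is only there
-- for termination; fuel n is always sufficient (m at least halves each step).
factoradicGo : ℕ → ℕ → ℕ → List ℕ
factoradicGo zero    i m       = []
factoradicGo (suc f) i zero    = []
factoradicGo (suc f) i (suc m) =
  (suc m % suc i) ∷ factoradicGo f (suc i) (suc m / suc i)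

factoradicDigits : ℕ → List ℕ
factoradicDigits n = factoradicGo n 1 n

-- The e-power factoradic happy function S_{e,!}; S_{e,!}(0) = 0 since the
-- digit list of 0 is empty.
S! : ℕ → ℕ → ℕ
S! e n = sum (map (λ a → a ^ e) (factoradicDigits n))

iter : (ℕ → ℕ) → ℕ → ℕ → ℕ
iter f zero    x = x
iter f (suc ℓ) x = f (iter f ℓ x)

IsFixedPoint : ℕ → ℕ → Set
IsFixedPoint e p = (0 < p) × (S! e p ≡ p)

IsHappy : ℕ → ℕ → ℕ → Set
IsHappy e p x = (0 < x) × (∃[ ℓ ] (iter (S! e) ℓ x ≡ p))

-- Writing 1, …, 1 (A digits) above the factoradic digits of a number r < (d+1)! raises
-- S_{e,!} by exactly A.  So if S_{e,!}(L + w) ∈ W for all w ∈ W' (with L + W' below a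
-- factorial) and some translate of W consists of p-happy numbers, then so does some translate
-- of W'.  For e ≤ 4 one has S_{e,!}(k) < k for k ≥ 720 = 6! (digits from position 6 on
-- add at least 6! − 6³ = 504 more to k than to S_{4,!}(k)) and S_{e,!}(k) ≤ k + 260 below 720.
-- Hence S_{e,!} maps {0, …, m} into {0, …, m − 1} once m ≥ 981, all fixed points lie below
-- 720, and by induction on m everything reduces to a happy translate of {0, …, 980}, which is
-- found by computation for each fixed point.

module Submission where

open import Defs
open import Data.Nat
open import Data.Nat.Properties
open import Data.Nat.DivMod
open import Data.Nat.Divisibility using (divides-refl)
open import Data.Nat.Induction using (<-rec)
open import Data.Nat.ListAction using (sum)
open import Data.Nat.Tactic.RingSolver using (solve-∀)
open import Data.List using (List; []; _∷_; [_]; map; upTo; iterate; deduplicate)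
open import Data.List.Relation.Unary.All as All using (All; []; _∷_)
open import Data.List.Relation.Unary.All.Properties using (anti-mono; map⁻)
open import Data.List.Relation.Unary.Any as Any using (Any; here; there)
open import Data.List.Relation.Binary.Subset.Propositional using (_⊆_)
open import Data.List.Membership.Propositional.Properties using (∈-upTo⁺; ∈-upTo⁻; ∈-map⁻; ∈-deduplicate⁺)
open import Data.List.Membership.DecPropositional _≟_ using (_∈_; _∈?_)
open import Data.Product using (_×_; _,_; ∃-syntax; proj₁; proj₂)
open import Relation.Nullary using (Dec; yes; no; contradiction)
open import Relation.Nullary.Decidable using (_×-dec_; _→-dec_; toWitness)
open import Relation.Binary.PropositionalEquality hiding ([_])

-- The e-th power sum of the factoradic digits of m * (i + 1)!, that is, of m read as digits
-- at positions i + 1, i + 2, …; digitPowerSum e 0 is S! e.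
digitPowerSum : ℕ → ℕ → ℕ → ℕ
digitPowerSum e i m = sum (map (λ a → a ^ e) (factoradicGo m (suc i) m))

-- (i + d + 1)! / (i + 1)!: the place value of position i + d + 1 relative to position i + 1
factorialRatio : ℕ → ℕ → ℕ
factorialRatio i zero    = 1
factorialRatio i (suc d) = suc (suc i) * factorialRatio (suc i) d

-- repunit i A * (i + 1)! has factoradic digit 1 at positions i + 1, …, i + A and 0 elsewhere.
repunit : ℕ → ℕ → ℕ
repunit i zero    = 0
repunit i (suc A) = 1 + repunit (suc i) A * suc (suc i)

0^n≡0 : ∀ n .{{_ : NonZero n}} → 0 ^ n ≡ 0
0^n≡0 (suc n) = refl

[m+kn]/n≡m/n+k : ∀ m k n .{{_ : NonZero n}} → (m + k * n) / n ≡ m / n + k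
[m+kn]/n≡m/n+k m k n = trans (+-distrib-/-∣ʳ m (divides-refl k)) (cong (m / n +_) (m*n/n≡m k n))

n<factorialRatio : ∀ i n → n < factorialRatio i n
n<factorialRatio i zero    = z<s
n<factorialRatio i (suc n) =
  +-mono-≤ (≤-trans z<s ih) (≤-trans ih (m≤m+n _ _))
  where
  ih : n < factorialRatio (suc i) n
  ih = n<factorialRatio (suc i) n

factoradicGo-zero : ∀ f i → factoradicGo f i 0 ≡ []
factoradicGo-zero zero    i = refl
factoradicGo-zero (suc f) i = refl

factoradicGo-fuel : ∀ i m {f g} → m ≤ f → m ≤ g →
                    factoradicGo f (suc i) m ≡ factoradicGo g (suc i) m
factoradicGo-fuel i zero {f} {g} _ _ = trans (factoradicGo-zero f _) (sym (factoradicGo-zero g _))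
factoradicGo-fuel i (suc m) {suc f} {suc g} (s≤s m≤f) (s≤s m≤g) =
  cong (suc m % suc (suc i) ∷_) (factoradicGo-fuel (suc i) q (≤-trans q≤m m≤f) (≤-trans q≤m m≤g))
  where
  q = suc m / suc (suc i)
  q≤m : q ≤ m
  q≤m = ≤-pred (m/n<m (suc m) (suc (suc i)) (s≤s (s≤s z≤n)))

digitPowerSum-unfold : ∀ e .{{_ : NonZero e}} i m →
  digitPowerSum e i m ≡ (m % suc (suc i)) ^ e + digitPowerSum e (suc i) (m / suc (suc i))
digitPowerSum-unfold e i zero    = sym (trans (+-identityʳ (0 ^ e)) (0^n≡0 e))
digitPowerSum-unfold e i (suc m) =
  cong (λ ds → (suc m % n) ^ e + sum (map (λ a → a ^ e) ds)) (factoradicGo-fuel (suc i) q q≤m ≤-refl)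
  where
  n = suc (suc i)
  q = suc m / n
  q≤m : q ≤ m
  q≤m = ≤-pred (m/n<m (suc m) n (s≤s (s≤s z≤n)))

digitPowerSum-concat : ∀ e .{{_ : NonZero e}} d i r H → r < factorialRatio i d →
  digitPowerSum e i (r + factorialRatio i d * H) ≡ digitPowerSum e i r + digitPowerSum e (d + i) H
digitPowerSum-concat e zero    i zero    H _ = cong (digitPowerSum e i) (+-identityʳ H)
digitPowerSum-concat e zero    i (suc r) H (s≤s ())
digitPowerSum-concat e (suc d) i r       H r<ratio = begin
    digitPowerSum e i (r + (n * q) * H)
  ≡⟨ cong (λ x → digitPowerSum e i (r + x)) (reorder n q H) ⟩
    digitPowerSum e i (r + (q * H) * n)
  ≡⟨ digitPowerSum-unfold e i (r + (q * H) * n) ⟩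
    ((r + (q * H) * n) % n) ^ e + digitPowerSum e (suc i) ((r + (q * H) * n) / n)
  ≡⟨ cong₂ (λ a x → a ^ e + digitPowerSum e (suc i) x) ([m+kn]%n≡m%n r (q * H) n) ([m+kn]/n≡m/n+k r (q * H) n) ⟩
    (r % n) ^ e + digitPowerSum e (suc i) (r / n + q * H)
  ≡⟨ cong ((r % n) ^ e +_) (digitPowerSum-concat e d (suc i) (r / n) H r/n<q) ⟩
    (r % n) ^ e + (digitPowerSum e (suc i) (r / n) + digitPowerSum e (d + suc i) H)
  ≡⟨ sym (+-assoc ((r % n) ^ e) _ _) ⟩
    ((r % n) ^ e + digitPowerSum e (suc i) (r / n)) + digitPowerSum e (d + suc i) H
  ≡⟨ cong₂ _+_ (sym (digitPowerSum-unfold e i r)) (cong (λ j → digitPowerSum e j H) (+-suc d i)) ⟩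
    digitPowerSum e i r + digitPowerSum e (suc d + i) H
  ∎
  where
  open ≡-Reasoning
  n = suc (suc i)
  q = factorialRatio (suc i) d
  reorder : ∀ n q H → (n * q) * H ≡ (q * H) * n
  reorder = solve-∀
  r/n<q : r / n < q
  r/n<q = m<n*o⇒m/o<n (subst (r <_) (*-comm n q) r<ratio)

digitPowerSum-repunit : ∀ e .{{_ : NonZero e}} i A → digitPowerSum e i (repunit i A) ≡ A
digitPowerSum-repunit e i zero    = refl
digitPowerSum-repunit e i (suc A) = begin
    digitPowerSum e i (1 + y * n)
  ≡⟨ digitPowerSum-unfold e i (1 + y * n) ⟩
    ((1 + y * n) % n) ^ e + digitPowerSum e (suc i) ((1 + y * n) / n)
  ≡⟨ cong₂ (λ a x → a ^ e + digitPowerSum e (suc i) x) ([m+kn]%n≡m%n 1 y n) ([m+kn]/n≡m/n+k 1 y n) ⟩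
    1 ^ e + digitPowerSum e (suc i) y
  ≡⟨ cong₂ _+_ (^-zeroˡ e) (digitPowerSum-repunit e (suc i) A) ⟩
    1 + A
  ∎
  where
  open ≡-Reasoning
  n = suc (suc i)
  y = repunit (suc i) A

S!-+-repunit : ∀ e .{{_ : NonZero e}} d r A → r < factorialRatio 0 d →
               S! e (r + factorialRatio 0 d * repunit d A) ≡ S! e r + A
S!-+-repunit e d r A r<ratio = begin
    digitPowerSum e 0 (r + factorialRatio 0 d * repunit d A)
  ≡⟨ digitPowerSum-concat e d 0 r (repunit d A) r<ratio ⟩
    digitPowerSum e 0 r + digitPowerSum e (d + 0) (repunit d A)
  ≡⟨ cong (λ j → S! e r + digitPowerSum e j (repunit d A)) (+-identityʳ d) ⟩
    S! e r + digitPowerSum e d (repunit d A)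
  ≡⟨ cong (S! e r +_) (digitPowerSum-repunit e d A) ⟩
    S! e r + A
  ∎
  where open ≡-Reasoning

cube+504-growth : ∀ t → (7 + t) * ((6 + t) * ((6 + t) * ((6 + t) * 1)) + 504)
  ≡ ((7 + t) * ((7 + t) * ((7 + t) * 1)) + 504) + (t * t * t * t + 24 * (t * t * t) + 213 * (t * t) + 1329 * t + 4193)
cube+504-growth = solve-∀

cube+504≤factorial : ∀ t → (6 + t) ^ 3 + 504 ≤ (6 + t) !
cube+504≤factorial zero    = ≤-refl
cube+504≤factorial (suc t) = begin
    (7 + t) ^ 3 + 504              ≤⟨ m≤m+n _ _ ⟩
    ((7 + t) ^ 3 + 504) + _        ≡⟨ cube+504-growth t ⟨
    (7 + t) * ((6 + t) ^ 3 + 504)  ≤⟨ *-monoʳ-≤ (7 + t) (cube+504≤factorial t) ⟩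
    (7 + t) * (6 + t) !            ∎
  where open ≤-Reasoning

a^4+a*504≤a*[6+t]! : ∀ t a → a ≤ 6 + t → a ^ 4 + a * 504 ≤ a * (6 + t) !
a^4+a*504≤a*[6+t]! t a a≤6+t = begin
  a ^ 4 + a * 504              ≤⟨ +-monoˡ-≤ (a * 504) (*-monoʳ-≤ a (^-monoˡ-≤ 3 a≤6+t)) ⟩
  a * (6 + t) ^ 3 + a * 504    ≡⟨ *-distribˡ-+ a ((6 + t) ^ 3) 504 ⟨
  a * ((6 + t) ^ 3 + 504)      ≤⟨ *-monoʳ-≤ a (cube+504≤factorial t) ⟩
  a * (6 + t) !                ∎
  where open ≤-Reasoning

digitPowerSum⁴+504≤m*[6+t]! : ∀ m t → 1 ≤ m → digitPowerSum 4 (5 + t) m + 504 ≤ m * (6 + t) !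
digitPowerSum⁴+504≤m*[6+t]! = <-rec _ bound
  where
  bound : ∀ m → (∀ {q} → q < m → ∀ t → 1 ≤ q → digitPowerSum 4 (5 + t) q + 504 ≤ q * (6 + t) !) →
          ∀ t → 1 ≤ m → digitPowerSum 4 (5 + t) m + 504 ≤ m * (6 + t) !
  bound m rec t 1≤m with m / (7 + t) in q≡
  ... | zero = begin
      digitPowerSum 4 (5 + t) m + 504  ≡⟨ cong (_+ 504) unfold ⟩
      a ^ 4 + 0 + 504                  ≡⟨ cong (_+ 504) (+-identityʳ (a ^ 4)) ⟩
      a ^ 4 + 504                      ≤⟨ +-monoʳ-≤ (a ^ 4) (*-monoˡ-≤ 504 1≤a) ⟩
      a ^ 4 + a * 504                  ≤⟨ top ⟩
      a * (6 + t) !                    ≡⟨ cong (_* (6 + t) !) a≡m ⟩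
      m * (6 + t) !                    ∎
    where
    open ≤-Reasoning
    a = m % (7 + t)
    top : a ^ 4 + a * 504 ≤ a * (6 + t) !
    top = a^4+a*504≤a*[6+t]! t a (≤-pred (m%n<n m (7 + t)))
    unfold : digitPowerSum 4 (5 + t) m ≡ a ^ 4 + 0
    unfold = trans (digitPowerSum-unfold 4 (5 + t) m)
                   (cong (λ q → a ^ 4 + digitPowerSum 4 (6 + t) q) q≡)
    a≡m : a ≡ m
    a≡m = sym (trans (m≡m%n+[m/n]*n m (7 + t)) (trans (cong (λ q → a + q * (7 + t)) q≡) (+-identityʳ a)))
    1≤a : 1 ≤ a
    1≤a = subst (1 ≤_) (sym a≡m) 1≤m
  ... | suc _ = begin
      digitPowerSum 4 (5 + t) m + 504            ≡⟨ cong (_+ 504) (digitPowerSum-unfold 4 (5 + t) m) ⟩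
      a ^ 4 + digitPowerSum 4 (6 + t) q + 504    ≡⟨ +-assoc (a ^ 4) _ 504 ⟩
      a ^ 4 + (digitPowerSum 4 (6 + t) q + 504)  ≤⟨ +-mono-≤ (≤-trans (m≤m+n (a ^ 4) (a * 504)) top) high ⟩
      a * F + q * (n * F)                        ≡⟨ decompose ⟨
      m * F                                      ∎
    where
    open ≤-Reasoning
    n = 7 + t
    a = m % n
    q = m / n
    F = (6 + t) !
    top : a ^ 4 + a * 504 ≤ a * F
    top = a^4+a*504≤a*[6+t]! t a (≤-pred (m%n<n m n))
    high : digitPowerSum 4 (6 + t) q + 504 ≤ q * (n * F)
    high = rec (m/n<m m n {{>-nonZero 1≤m}} (s≤s (s≤s z≤n))) (suc t) (subst (1 ≤_) (sym q≡) z<s)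
    decompose : m * F ≡ a * F + q * (n * F)
    decompose = begin-equality
      m * F                ≡⟨ cong (_* F) (m≡m%n+[m/n]*n m n) ⟩
      (a + q * n) * F      ≡⟨ *-distribʳ-+ F a (q * n) ⟩
      a * F + q * n * F    ≡⟨ cong (a * F +_) (*-assoc q n F) ⟩
      a * F + q * (n * F)  ∎

digitPowerSum-mono-exponent : ∀ e .{{_ : NonZero e}} e' → e ≤ e' → ∀ i m →
                              digitPowerSum e i m ≤ digitPowerSum e' i m
digitPowerSum-mono-exponent e e' e≤e' i m = sum-mono (factoradicGo m (suc i) m)
  where
  power-mono : ∀ a → a ^ e ≤ a ^ e'
  power-mono zero    = ≤-trans (≤-reflexive (0^n≡0 e)) z≤n
  power-mono (suc a) = ^-monoʳ-≤ (suc a) e≤e'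
  sum-mono : ∀ ds → sum (map (λ a → a ^ e) ds) ≤ sum (map (λ a → a ^ e') ds)
  sum-mono []       = z≤n
  sum-mono (d ∷ ds) = +-mono-≤ (power-mono d) (sum-mono ds)

-- Split k = r + 720 H with r < 6!: the digits of H add at least 504 less to S! e k than to k,
-- which outweighs the at most 260 gained on r.
720≤k⇒S!k<k : ∀ e .{{_ : NonZero e}} → e ≤ 4 → (∀ {r} → r < 720 → S! e r ≤ r + 260) →
               ∀ k → 720 ≤ k → S! e k < k
720≤k⇒S!k<k e e≤4 small k 720≤k = begin-strict
    S! e k            <⟨ m<m+n (S! e k) {244} z<s ⟩
    S! e k + 244      ≤⟨ +-cancelʳ-≤ 260 _ k (subst (_≤ k + 260) (sym (+-assoc (S! e k) 244 260)) S!k+504≤k+260) ⟩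
    k                 ∎
  where
  open ≤-Reasoning
  r = k % 720
  H = k / 720
  r<720 : r < 720
  r<720 = m%n<n k 720
  split : S! e k ≡ S! e r + digitPowerSum e 5 H
  split = trans (cong (S! e) (trans (m≡m%n+[m/n]*n k 720) (cong (r +_) (*-comm H 720))))
                (digitPowerSum-concat e 5 0 r H r<720)
  regroup : ∀ r x → r + 260 + x ≡ r + x + 260
  regroup = solve-∀
  S!k+504≤k+260 : S! e k + 504 ≤ k + 260
  S!k+504≤k+260 = begin
      S! e k + 504                          ≡⟨ cong (_+ 504) split ⟩
      S! e r + digitPowerSum e 5 H + 504    ≡⟨ +-assoc (S! e r) _ 504 ⟩
      S! e r + (digitPowerSum e 5 H + 504)
        ≤⟨ +-mono-≤ (small r<720) (+-monoˡ-≤ 504 (digitPowerSum-mono-exponent e 4 e≤4 5 H)) ⟩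
      r + 260 + (digitPowerSum 4 5 H + 504) ≤⟨ +-monoʳ-≤ (r + 260) (digitPowerSum⁴+504≤m*[6+t]! H 0 (m≥n⇒m/n>0 720≤k)) ⟩
      r + 260 + H * 720                     ≡⟨ regroup r (H * 720) ⟩
      r + H * 720 + 260                     ≡⟨ cong (_+ 260) (m≡m%n+[m/n]*n k 720) ⟨
      k + 260                               ∎

iter-suc : ∀ (f : ℕ → ℕ) ℓ x → iter f (suc ℓ) x ≡ iter f ℓ (f x)
iter-suc f zero    x = refl
iter-suc f (suc ℓ) x = cong f (iter-suc f ℓ x)

∈-iterate⁻ : ∀ (f : ℕ → ℕ) n {x y} → y ∈ iterate f x n → ∃[ ℓ ] iter f ℓ x ≡ y
∈-iterate⁻ f (suc n)     (here y≡x)  = zero , sym y≡x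
∈-iterate⁻ f (suc n) {x} (there y∈) with ∈-iterate⁻ f n y∈
... | ℓ , eq = suc ℓ , trans (iter-suc f ℓ x) eq

IsHappy-S! : ∀ e p x → IsHappy e p (S! e x) → IsHappy e p x
IsHappy-S! e p zero    (() , _)
IsHappy-S! e p (suc x) (_ , ℓ , eq) = z<s , suc ℓ , trans (iter-suc (S! e) ℓ (suc x)) eq

HasHappyTranslate : ℕ → ℕ → List ℕ → Set
HasHappyTranslate e p W = ∃[ A ] All (λ w → IsHappy e p (A + w)) W

HasHappyTranslate-⊆ : ∀ {e p W W'} → W ⊆ W' → HasHappyTranslate e p W' → HasHappyTranslate e p W
HasHappyTranslate-⊆ W⊆W' (A , happy) = A , anti-mono W⊆W' happy

HasHappyTranslate-pullback : ∀ e .{{_ : NonZero e}} p d L W → All (λ w → L + w < factorialRatio 0 d) W →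
  HasHappyTranslate e p (map (λ w → S! e (L + w)) W) → HasHappyTranslate e p W
HasHappyTranslate-pullback e p d L W small (A , happy) =
  L + F * repunit d A , All.zipWith happy-at (small , map⁻ happy)
  where
  F = factorialRatio 0 d
  happy-at : ∀ {w} → L + w < F × IsHappy e p (A + S! e (L + w)) → IsHappy e p (L + F * repunit d A + w)
  happy-at {w} (L+w<F , happy-image) = IsHappy-S! e p _ (subst (IsHappy e p) (sym image) happy-image)
    where
    open ≡-Reasoning
    image : S! e (L + F * repunit d A + w) ≡ A + S! e (L + w)
    image = begin
      S! e (L + F * repunit d A + w)   ≡⟨ cong (S! e) (+-assoc L _ w) ⟩
      S! e (L + (F * repunit d A + w)) ≡⟨ cong (λ x → S! e (L + x)) (+-comm _ w) ⟩
      S! e (L + (w + F * repunit d A)) ≡⟨ cong (S! e) (+-assoc L w _) ⟨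
      S! e (L + w + F * repunit d A)   ≡⟨ S!-+-repunit e d (L + w) A L+w<F ⟩
      S! e (L + w) + A                 ≡⟨ +-comm _ A ⟩
      A + S! e (L + w)                 ∎

HasHappyTranslate-upTo : ∀ e .{{_ : NonZero e}} p c → (∀ k → S! e k < c ⊔ k) →
  HasHappyTranslate e p (upTo c) → ∀ m → HasHappyTranslate e p (upTo m)
HasHappyTranslate-upTo e p c S!<c⊔k base zero = 0 , []
HasHappyTranslate-upTo e p c S!<c⊔k base (suc m) with suc m ≤? c
... | yes m<c = HasHappyTranslate-⊆ {e} {p} (λ k∈ → ∈-upTo⁺ (≤-trans (∈-upTo⁻ k∈) m<c)) base
... | no m≮c  = HasHappyTranslate-pullback e p (suc m) 0 (upTo (suc m))
                  (All.tabulate (λ k∈ → <-trans (∈-upTo⁻ k∈) (n<factorialRatio 0 (suc m))))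
                  (HasHappyTranslate-⊆ {e} {p} S![0,m]⊆[0,m[ (HasHappyTranslate-upTo e p c S!<c⊔k base m))
  where
  S![0,m]⊆[0,m[ : map (S! e) (upTo (suc m)) ⊆ upTo m
  S![0,m]⊆[0,m[ y∈ with ∈-map⁻ (S! e) y∈
  ... | k , k∈ , refl = ∈-upTo⁺ (<-≤-trans (S!<c⊔k k) (⊔-lub (≤-pred (≰⇒> m≮c)) (≤-pred (∈-upTo⁻ k∈))))

shiftedImage : ℕ → ℕ → List ℕ → List ℕ
shiftedImage e L W = deduplicate _≟_ (map (λ w → S! e (L + w)) W)

HappyCertificate : ℕ → ℕ → List ℕ → List ℕ → ℕ → Set
HappyCertificate e p W []       A = All (λ w → 0 < A + w × p ∈ iterate (S! e) (A + w) 100) W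
HappyCertificate e p W (L ∷ Ls) A =
  All (λ w → L + w < factorialRatio 0 7) W × HappyCertificate e p (shiftedImage e L W) Ls A

happyCertificate? : ∀ e p W Ls A → Dec (HappyCertificate e p W Ls A)
happyCertificate? e p W []       A = All.all? (λ w → 0 <? A + w ×-dec p ∈? iterate (S! e) (A + w) 100) W
happyCertificate? e p W (L ∷ Ls) A =
  All.all? (λ w → L + w <? factorialRatio 0 7) W ×-dec happyCertificate? e p (shiftedImage e L W) Ls A

HappyCertificate-sound : ∀ e .{{_ : NonZero e}} p W Ls A → HappyCertificate e p W Ls A → HasHappyTranslate e p W
HappyCertificate-sound e p W []       A final = A , All.map (λ (pos , reach) → pos , ∈-iterate⁻ (S! e) 100 reach) final
HappyCertificate-sound e p W (L ∷ Ls) A (small , rest) =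
  HasHappyTranslate-pullback e p 7 L W small
    (HasHappyTranslate-⊆ {e} {p} (∈-deduplicate⁺ _≟_) (HappyCertificate-sound e p (shiftedImage e L W) Ls A rest))

-- Found by computer search.
happyRunCertificates : ℕ → List (ℕ × List ℕ × ℕ)
happyRunCertificates 1 = (1 , [ 0 ] , 1) ∷ []
happyRunCertificates 2 =
  (1 , [ 0 ] , 160473) ∷
  (4 , 0 ∷ 514 ∷ 1733 ∷ 3952 ∷ [] , 201555) ∷
  (5 , 0 ∷ 873 ∷ 883 ∷ [] , 372) ∷ []
happyRunCertificates 3 =
  (1 , [ 0 ] , 4860) ∷
  (16 , 0 ∷ 726 ∷ 1690 ∷ 2650 ∷ 3744 ∷ 3989 ∷ 3168 ∷ [] , 1618) ∷
  (17 , 0 ∷ 4323 ∷ 3755 ∷ 354 ∷ 2572 ∷ [] , 4307) ∷ []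
happyRunCertificates 4 =
  (1 , [ 0 ] , 40) ∷
  (658 , 0 ∷ 130 ∷ 874 ∷ 2809 ∷ 2809 ∷ 2420 ∷ 3970 ∷ [] , 229450) ∷
  (659 , 0 ∷ 874 ∷ 858 ∷ 34 ∷ 3764 ∷ 247 ∷ 2392 ∷ 3560 ∷ [] , 8853) ∷ []
happyRunCertificates _ = []

CertifiedFixedPoint : ℕ → ℕ → Set
CertifiedFixedPoint e p =
  Any (λ (q , Ls , A) → q ≡ p × HappyCertificate e p (upTo 981) Ls A) (happyRunCertificates e)

ExponentCertificate : ℕ → Set
ExponentCertificate e =
  (∀ {r} → r < 720 → S! e r ≤ r + 260) × (∀ {p} → p < 720 → IsFixedPoint e p → CertifiedFixedPoint e p)

exponentCertificate? : ∀ e → Dec (ExponentCertificate e)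
exponentCertificate? e =
  allUpTo? (λ r → S! e r ≤? r + 260) 720 ×-dec
  allUpTo? (λ p → (0 <? p ×-dec S! e p ≟ p) →-dec
                  Any.any? (λ (q , Ls , A) → q ≟ p ×-dec happyCertificate? e p (upTo 981) Ls A)
                           (happyRunCertificates e)) 720

exponentCertificate : ∀ e → 1 ≤ e → e ≤ 4 → ExponentCertificate e
exponentCertificate 1 _ _ = toWitness {a? = exponentCertificate? 1} _
exponentCertificate 2 _ _ = toWitness {a? = exponentCertificate? 2} _
exponentCertificate 3 _ _ = toWitness {a? = exponentCertificate? 3} _
exponentCertificate 4 _ _ = toWitness {a? = exponentCertificate? 4} _
exponentCertificate (suc (suc (suc (suc (suc _))))) _ (s≤s (s≤s (s≤s (s≤s ()))))

-- 981 = 720 + 260 + 1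
S!<981⊔n : ∀ e .{{_ : NonZero e}} → e ≤ 4 → (∀ {r} → r < 720 → S! e r ≤ r + 260) →
           ∀ n → S! e n < 981 ⊔ n
S!<981⊔n e e≤4 small n with n <? 720
... | yes n<720 = ≤-trans (m≤n⇒m≤1+n (s≤s (≤-trans (small n<720) (+-monoˡ-≤ 260 (≤-pred n<720))))) (m≤m⊔n 981 n)
... | no  n≮720 = <-≤-trans (720≤k⇒S!k<k e e≤4 small n (≮⇒≥ n≮720)) (m≤n⊔m 981 n)

fixedPoint<720 : ∀ e .{{_ : NonZero e}} → e ≤ 4 → (∀ {r} → r < 720 → S! e r ≤ r + 260) →
                 ∀ p → IsFixedPoint e p → p < 720
fixedPoint<720 e e≤4 small p (_ , S!p≡p) with p <? 720
... | yes p<720 = p<720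
... | no  p≮720 = contradiction (720≤k⇒S!k<k e e≤4 small p (≮⇒≥ p≮720)) (<-irrefl S!p≡p)

CertifiedFixedPoint-sound : ∀ e .{{_ : NonZero e}} p → CertifiedFixedPoint e p → HasHappyTranslate e p (upTo 981)
CertifiedFixedPoint-sound e p certified with Any.satisfied certified
... | (_ , Ls , A) , _ , certificate = HappyCertificate-sound e p (upTo 981) Ls A certificate

theorem1p4 : ∀ (e : ℕ) → 1 ≤ e → e ≤ 4 → ∀ (p : ℕ) → IsFixedPoint e p →
    ∀ (m : ℕ) → ∃[ N ] (∀ (k : ℕ) → k < m → IsHappy e p (N + k))
theorem1p4 e 1≤e e≤4 p fixed m = N , λ k k<m → All.lookup happy (∈-upTo⁺ k<m)
  where
  instance
    e≢0 : NonZero e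
    e≢0 = >-nonZero 1≤e
  small : ∀ {r} → r < 720 → S! e r ≤ r + 260
  small = proj₁ (exponentCertificate e 1≤e e≤4)
  certified : CertifiedFixedPoint e p
  certified = proj₂ (exponentCertificate e 1≤e e≤4) (fixedPoint<720 e e≤4 small p fixed) fixed
  run : HasHappyTranslate e p (upTo m)
  run = HasHappyTranslate-upTo e p 981 (S!<981⊔n e e≤4 small) (CertifiedFixedPoint-sound e p certified) m
  N = proj₁ run
  happy = proj₂ run
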